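{- Let $\approx$ be an SCER on $\Sigma^*$ and $T$ a string of length $n$. A string $C$ of length $c$ is a proper $\approx$-cover of $T$ if and only if $C\in\mathsf{Bord}_{\approx}(T)$ and $C\in\mathsf{Cov}_{\approx}(T[:n-i])$ for some $1\le i\le c$.
   Context: $\Sigma^*$ is the set of strings over an alphabet $\Sigma$. For a string $T$, $|T|$ is its length, $T[i:j]$ the substring from position $i$ to $j$, $T[:j]=T[1:j]$, $T[i:]=T[i:|T|]$. An SCER is an equivalence relation $\approx$ on $\Sigma^*$ such that $X\approx Y$ implies $|X|=|Y|$ and $X[i:j]\approx Y[i:j]$ for all $1\le i\le j\le|X|$. $\mathsf{Occ}_{P,T}=\{\,i : 1\le i\le |T|-|P|+1,\ P\approx T[i:i+|P|-1]\,\}$. $\mathsf{Bord}_\approx(T)$ is the set of strings $B$ with $B\approx T[:|B|]\approx T[|T|-|B|+1:]$. A string $C$ of length $c$ is a $\approx$-cover of $T$ of length $n$ if there are $x_1,\dots,x_m\in\mathsf{Occ}_{C,T}$ with $x_1=1$, $x_m=n-c+1$ and $x_{i-1}<x_i\le x_{i-1}+c$ for all $1<i\le m$; it is proper if $c<n$; $\mathsf{Cov}_\approx(T)$ is the set of all $\approx$-covers of $T$. -}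

module Defs where

open import Level using (Level; _⊔_; suc)
open import Data.Nat using (ℕ; _+_; _∸_; _≤_; _<_)
open import Data.List using (List; length; take; drop)
open import Data.List.NonEmpty using (List⁺; head; last; toList)
open import Data.List.Relation.Unary.All using (All)
open import Data.List.Relation.Unary.Linked using (Linked)
open import Data.Product using (Σ; _×_)
open import Relation.Binary.Core using (Rel)
open import Relation.Binary.Structures using (IsEquivalence)
open import Relation.Binary.PropositionalEquality using (_≡_)

-- Strings over an alphabet A are lists; positions are 1-based as in the paper.

-- T[i:j] (1-based, inclusive)
sub : ∀ {a} {A : Set a} → List A → ℕ → ℕ → List A
sub T i j = take ((j + 1) ∸ i) (drop (i ∸ 1) T)

pre : ∀ {a} {A : Set a} → List A → ℕ → List A
pre T j = take j T

suf : ∀ {a} {A : Set a} → List A → ℕ → List A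
suf T i = sub T i (length T)

record SCER {a} (A : Set a) ℓ : Set (a ⊔ suc ℓ) where
  field
    _≈_     : Rel (List A) ℓ
    isEquivalence : IsEquivalence _≈_
    ≈-length : ∀ {X Y} → X ≈ Y → length X ≡ length Y
    ≈-sub    : ∀ {X Y} → X ≈ Y → ∀ i j → 1 ≤ i → i ≤ j → j ≤ length X →
               sub X i j ≈ sub Y i j

module _ {a ℓ} {A : Set a} (S : SCER A ℓ) where
  open SCER S

  Occ : List A → List A → ℕ → Set ℓ
  Occ P T i = (1 ≤ i) × (i ≤ (length T + 1) ∸ length P) ×
              (P ≈ sub T i ((i + length P) ∸ 1))

  Bord : List A → List A → Set ℓ
  Bord B T = (B ≈ pre T (length B)) ×
             (pre T (length B) ≈ suf T ((length T + 1) ∸ length B))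

  Step : ℕ → ℕ → ℕ → Set
  Step c x y = (x < y) × (y ≤ x + c)

  Cov : List A → List A → Set ℓ
  Cov C T = Σ (List⁺ ℕ) λ xs →
    All (Occ C T) (toList xs) ×
    (head xs ≡ 1) ×
    (last xs ≡ (length T ∸ length C) + 1) ×
    Linked (Step (length C)) (toList xs)

  ProperCov : List A → List A → Set ℓ
  ProperCov C T = Cov C T × (length C < length T)

-- A proper cover C of T begins and ends with occurrences of C, so C is a border
-- of T.  Dropping the last occurrence x_m = n − c + 1 leaves a cover of the
-- prefix ending where the previous occurrence x_{m−1} ends; since
-- x_{m−1} < x_m ≤ x_{m−1} + c, this prefix is T[:n−i] with i = x_m − x_{m−1}
-- in [1, c].  Conversely, a cover of T[:n−i] is extended to a cover of T by
-- appending the occurrence of the border C as a suffix, which starts i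
-- positions after the last occurrence in T[:n−i].
module Submission where

open import Defs
open import Level using (Level)
open import Data.Nat using (ℕ; _∸_; _≤_)
open import Data.List using (List; length)
open import Data.Product using (Σ; _×_)
open import Function.Bundles using (_⇔_)

open import Data.Nat using (suc; _+_; _<_; _⊓_; s≤s; s≤s⁻¹; z≤n)
open import Data.Nat.Properties
open import Algebra.Properties.CommutativeSemigroup +-commutativeSemigroup
  using (xy∙z≈xz∙y)
open import Data.List using ([]; _∷_; _∷ʳ_; take; drop; initLast; _∷ʳ′_)
open import Data.List.Properties using (length-take; take-drop; take-take)
open import Data.List.NonEmpty as List⁺ using (List⁺; last; toList; _⁺∷ʳ_; snocView; _∷ʳ′_)
open import Data.List.Relation.Unary.All as All using (All; []; _∷_)
open import Data.List.Relation.Unary.All.Properties using (∷ʳ⁺; ∷ʳ⁻)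
open import Data.List.Relation.Unary.Linked using (Linked; [-]; _∷_)
open import Data.Product using (_,_; proj₁; proj₂; ∃-syntax)
open import Data.Empty using (⊥-elim)
open import Relation.Binary.Core using (Rel)
open import Relation.Binary.Structures using (IsEquivalence)
open import Relation.Binary.PropositionalEquality
  using (_≡_; refl; sym; trans; cong; cong₂; subst; subst₂; module ≡-Reasoning)
open import Function.Bundles using (mk⇔; Equivalence)

open Equivalence using (to; from)
open ≡-Reasoning

module _ {a} {A : Set a} where

  last-∷ : ∀ (x y : A) ys → last (x List⁺.∷ y ∷ ys) ≡ last (y List⁺.∷ ys)
  last-∷ x y ys with initLast ys
  ... | []       = refl
  ... | zs ∷ʳ′ z = refl

  last-⁺∷ʳ : ∀ x (xs : List A) y → last ((x List⁺.∷ xs) ⁺∷ʳ y) ≡ y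
  last-⁺∷ʳ x []       y = refl
  last-⁺∷ʳ x (z ∷ zs) y = trans (last-∷ x z (zs ∷ʳ y)) (last-⁺∷ʳ z zs y)

  All-last : ∀ {p} {P : A → Set p} x xs → All P (x ∷ xs) → P (last (x List⁺.∷ xs))
  All-last x []       (px ∷ [])  = px
  All-last {P = P} x (y ∷ ys) (_ ∷ pys) = subst P (sym (last-∷ x y ys)) (All-last y ys pys)

  module _ {r} {R : Rel A r} where

    Linked-⁺∷ʳ⁺ : ∀ x xs {y} → Linked R (x ∷ xs) → R (last (x List⁺.∷ xs)) y →
                  Linked R (toList ((x List⁺.∷ xs) ⁺∷ʳ y))
    Linked-⁺∷ʳ⁺ x []       [-]         Rxy = Rxy ∷ [-]
    Linked-⁺∷ʳ⁺ x (z ∷ zs) (Rxz ∷ Rzs) Rly =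
      Rxz ∷ Linked-⁺∷ʳ⁺ z zs Rzs (subst (λ l → R l _) (last-∷ x z zs) Rly)

    Linked-⁺∷ʳ⁻ : ∀ x xs {y} → Linked R (toList ((x List⁺.∷ xs) ⁺∷ʳ y)) →
                  Linked R (x ∷ xs) × R (last (x List⁺.∷ xs)) y
    Linked-⁺∷ʳ⁻ x []       (Rxy ∷ [-]) = [-] , Rxy
    Linked-⁺∷ʳ⁻ x (z ∷ zs) (Rxz ∷ Rzs) with Linked-⁺∷ʳ⁻ z zs Rzs
    ... | Rzs′ , Rly = Rxz ∷ Rzs′ , subst (λ l → R l _) (sym (last-∷ x z zs)) Rly

Linked⇒All-≤-last : ∀ {r} {R : Rel ℕ r} → (∀ {x y} → R x y → x ≤ y) →
                    ∀ x xs → Linked R (x ∷ xs) → All (_≤ last (x List⁺.∷ xs)) (x ∷ xs)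
Linked⇒All-≤-last R⇒≤ x []       [-]        = ≤-refl ∷ []
Linked⇒All-≤-last R⇒≤ x (y ∷ ys) (Rxy ∷ Rys)
  rewrite last-∷ x y ys with Linked⇒All-≤-last R⇒≤ y ys Rys
... | y≤l ∷ ys≤l = ≤-trans (R⇒≤ Rxy) y≤l ∷ y≤l ∷ ys≤l

1+m≤[n+1]∸o⇔m+o≤n : ∀ m n o → suc m ≤ (n + 1) ∸ o ⇔ m + o ≤ n
1+m≤[n+1]∸o⇔m+o≤n m n o rewrite +-comm n 1 = mk⇔ bound⇒ bound⇐
  where
  bound⇒ : suc m ≤ suc n ∸ o → m + o ≤ n
  bound⇒ h = s≤s⁻¹ (m≤o∸n⇒m+n≤o (suc m) o≤1+n h)
    where
    o≤1+n : o ≤ suc n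
    o≤1+n = <⇒≤ (m∸n≢0⇒n<m (λ eq → n≮0 (subst (suc m ≤_) eq h)))

  bound⇐ : m + o ≤ n → suc m ≤ suc n ∸ o
  bound⇐ h = m+n≤o⇒m≤o∸n (suc m) (s≤s h)

n∸c+1≡1+q+e⇒n∸e≡q+c : ∀ {n c q e} → c ≤ n → (n ∸ c) + 1 ≡ suc q + e → n ∸ e ≡ q + c
n∸c+1≡1+q+e⇒n∸e≡q+c {n} {c} {q} {e} c≤n eq = begin
  n ∸ e               ≡⟨ cong (_∸ e) (m∸n+n≡m c≤n) ⟨
  (n ∸ c) + c ∸ e     ≡⟨ cong (λ m → m + c ∸ e) n∸c≡q+e ⟩
  q + e + c ∸ e       ≡⟨ cong (_∸ e) (xy∙z≈xz∙y q e c) ⟩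
  q + c + e ∸ e       ≡⟨ m+n∸n≡m (q + c) e ⟩
  q + c               ∎
  where
  n∸c≡q+e : n ∸ c ≡ q + e
  n∸c≡q+e = suc-injective (trans (+-comm 1 (n ∸ c)) eq)

n∸c+1≡n∸i∸c+1+i : ∀ {n c i} → i ≤ n → c ≤ n ∸ i → (n ∸ c) + 1 ≡ ((n ∸ i) ∸ c + 1) + i
n∸c+1≡n∸i∸c+1+i {n} {c} {i} i≤n c≤n∸i = begin
  (n ∸ c) + 1               ≡⟨ cong (λ m → (m ∸ c) + 1) (m∸n+n≡m i≤n) ⟨
  ((n ∸ i) + i) ∸ c + 1     ≡⟨ cong (_+ 1) (+-∸-comm i c≤n∸i) ⟩
  ((n ∸ i) ∸ c + i) + 1     ≡⟨ xy∙z≈xz∙y ((n ∸ i) ∸ c) i 1 ⟩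
  ((n ∸ i) ∸ c + 1) + i     ∎

module _ {a} {A : Set a} where

  sub-suc : ∀ (T : List A) y c → sub T (suc y) (y + c) ≡ take c (drop y T)
  sub-suc T y c = cong (λ l → take l (drop y T))
    (trans (cong (_∸ suc y) (+-comm (y + c) 1)) (m+n∸m≡n y c))

  suf-∸ : ∀ (T : List A) {c} → c ≤ length T →
          suf T ((length T + 1) ∸ c) ≡ take c (drop (length T ∸ c) T)
  suf-∸ T {c} c≤n = begin
    sub T ((n + 1) ∸ c) n              ≡⟨ cong₂ (sub T) (trans (+-∸-comm 1 c≤n) (+-comm (n ∸ c) 1))
                                                       (sym (m∸n+n≡m c≤n)) ⟩
    sub T (suc (n ∸ c)) ((n ∸ c) + c)  ≡⟨ sub-suc T (n ∸ c) c ⟩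
    take c (drop (n ∸ c) T)            ∎
    where
    n : ℕ
    n = length T

  take-drop-take : ∀ c y {k} (T : List A) → y + c ≤ k →
                   take c (drop y (take k T)) ≡ take c (drop y T)
  take-drop-take c y {k} T y+c≤k = begin
    take c (drop y (take k T))        ≡⟨ take-drop c y (take k T) ⟩
    drop y (take (y + c) (take k T))  ≡⟨ cong (drop y) (take-take (y + c) k T) ⟩
    drop y (take ((y + c) ⊓ k) T)     ≡⟨ cong (λ l → drop y (take l T)) (m≤n⇒m⊓n≡m y+c≤k) ⟩
    drop y (take (y + c) T)           ≡⟨ take-drop c y T ⟨
    take c (drop y T)                 ∎

  length-take≤ : ∀ {k} (T : List A) → k ≤ length T → length (take k T) ≡ k
  length-take≤ {k} T k≤n = trans (length-take k T) (m≤n⇒m⊓n≡m k≤n)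

module _ {a ℓ} {A : Set a} (S : SCER A ℓ) where
  open SCER S
  open IsEquivalence isEquivalence using () renaming (sym to ≈-sym; trans to ≈-trans)

  Occ-suc⇔ : ∀ {C T} y → Occ S C T (suc y) ⇔
             (y + length C ≤ length T × C ≈ take (length C) (drop y T))
  Occ-suc⇔ {C} {T} y = mk⇔
    (λ (_ , bound , C≈) → to bounds bound , subst (C ≈_) (sub-suc T y (length C)) C≈)
    (λ (bound , C≈) → s≤s z≤n , from bounds bound , subst (C ≈_) (sym (sub-suc T y (length C))) C≈)
    where
    bounds : suc y ≤ (length T + 1) ∸ length C ⇔ y + length C ≤ length T
    bounds = 1+m≤[n+1]∸o⇔m+o≤n y (length T) (length C)

  Occ⇒length≤ : ∀ {C T i} → Occ S C T i → length C ≤ length T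
  Occ⇒length≤ {i = 0} (() , _)
  Occ⇒length≤ {C} {i = suc y} occ = ≤-trans (m≤n+m (length C) y) (proj₁ (to (Occ-suc⇔ y) occ))

  Occ-take⁺ : ∀ {C T} k {i} → (i + length C) ∸ 1 ≤ k → Occ S C T i → Occ S C (take k T) i
  Occ-take⁺ k {0} _ (() , _)
  Occ-take⁺ {C} {T} k {suc y} y+c≤k occ with to (Occ-suc⇔ y) occ
  ... | y+c≤n , C≈ = from (Occ-suc⇔ y)
    ( subst (_ ≤_) (sym (length-take k T)) (⊓-glb y+c≤k y+c≤n)
    , subst (C ≈_) (sym (take-drop-take (length C) y T y+c≤k)) C≈ )

  Occ-take⁻ : ∀ {C T} k {i} → Occ S C (take k T) i → Occ S C T i
  Occ-take⁻ k {0} (() , _)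
  Occ-take⁻ {C} {T} k {suc y} occ with to (Occ-suc⇔ y) occ
  ... | y+c≤k⊓n , C≈ = from (Occ-suc⇔ y)
    ( ≤-trans y+c≤k⊓n′ (m⊓n≤n k (length T))
    , subst (C ≈_) (take-drop-take (length C) y T (≤-trans y+c≤k⊓n′ (m⊓n≤m k (length T)))) C≈ )
    where
    y+c≤k⊓n′ : y + length C ≤ k ⊓ length T
    y+c≤k⊓n′ = subst (_ ≤_) (length-take k T) y+c≤k⊓n

  Occ-last⇔ : ∀ {C T} → length C ≤ length T →
              Occ S C T ((length T ∸ length C) + 1) ⇔ C ≈ suf T ((length T + 1) ∸ length C)
  Occ-last⇔ {C} {T} c≤n = mk⇔
    (λ occ → subst (C ≈_) (sym (suf-∸ T c≤n))
               (proj₂ (to (Occ-suc⇔ d) (subst (Occ S C T) (+-comm d 1) occ))))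
    (λ C≈ → subst (Occ S C T) (+-comm 1 d)
               (from (Occ-suc⇔ d) (≤-reflexive (m∸n+n≡m c≤n) , subst (C ≈_) (suf-∸ T c≤n) C≈)))
    where
    d : ℕ
    d = length T ∸ length C

  Step-+ : ∀ {c x e} → 1 ≤ e → e ≤ c → Step S c x (x + e)
  Step-+ {x = x} 1≤e e≤c = m<m+n x 1≤e , +-monoʳ-≤ x e≤c

  Step⇒+ : ∀ {c x y} → Step S c x y → ∃[ e ] (1 ≤ e × e ≤ c × y ≡ x + e)
  Step⇒+ {c} {x} {y} (x<y , y≤x+c) =
    y ∸ x , m<n⇒0<n∸m x<y , m≤n+o⇒m∸n≤o y x y≤x+c , sym (m+[n∸m]≡n (<⇒≤ x<y))

  Cov⇒Bord : ∀ {C T} → Cov S C T → Bord S C T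
  Cov⇒Bord {C} {T} (x List⁺.∷ xs , occs@(occ₁ ∷ _) , refl , last≡ , _) =
    C≈pre , ≈-trans (≈-sym C≈pre) (to (Occ-last⇔ c≤n) occₘ)
    where
    c≤n : length C ≤ length T
    c≤n = Occ⇒length≤ occ₁
    C≈pre : C ≈ pre T (length C)
    C≈pre = proj₂ (to (Occ-suc⇔ 0) occ₁)
    occₘ : Occ S C T ((length T ∸ length C) + 1)
    occₘ = subst (Occ S C T) last≡ (All-last x xs occs)

  Cov-take : ∀ {C T} q x xs → q + length C ≤ length T →
             All (Occ S C T) (x ∷ xs) → x ≡ 1 → last (x List⁺.∷ xs) ≡ suc q →
             Linked (Step S (length C)) (x ∷ xs) → Cov S C (take (q + length C) T)
  Cov-take {C} {T} q x xs k≤n occs x≡1 last≡ steps =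
    x List⁺.∷ xs , All.zipWith occ-take (positions≤ , occs) , x≡1 , last≡′ , steps
    where
    c k : ℕ
    c = length C
    k = q + c
    positions≤ : All (_≤ suc q) (x ∷ xs)
    positions≤ = subst (λ l → All (_≤ l) (x ∷ xs)) last≡
      (Linked⇒All-≤-last (λ step → <⇒≤ (proj₁ step)) x xs steps)
    occ-take : ∀ {z} → z ≤ suc q × Occ S C T z → Occ S C (take k T) z
    occ-take (z≤ , occ) = Occ-take⁺ k (∸-monoˡ-≤ 1 (+-monoˡ-≤ c z≤)) occ
    last≡′ : last (x List⁺.∷ xs) ≡ (length (take k T) ∸ c) + 1
    last≡′ = begin
      last (x List⁺.∷ xs)          ≡⟨ last≡ ⟩
      suc q                        ≡⟨ +-comm 1 q ⟩
      q + 1                        ≡⟨ cong (_+ 1) (m+n∸n≡m q c) ⟨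
      (k ∸ c) + 1                  ≡⟨ cong (λ l → (l ∸ c) + 1) (length-take≤ T k≤n) ⟨
      (length (take k T) ∸ c) + 1  ∎

  ProperCov⇒Cov-pre : ∀ {C T} → ProperCov S C T →
                      Σ ℕ (λ i → (1 ≤ i) × (i ≤ length C) × Cov S C (pre T (length T ∸ i)))
  ProperCov⇒Cov-pre {C} {T} ((xs , occs , x≡1 , last≡ , steps) , c<n) with snocView xs
  ... | [] ∷ʳ′ x =
    ⊥-elim (<⇒≱ c<n (m∸n≡0⇒m≤n (suc-injective (trans (+-comm 1 _) (trans (sym last≡) x≡1)))))
  ... | (x ∷ xs′) ∷ʳ′ L with ∷ʳ⁻ occs | Linked-⁺∷ʳ⁻ x xs′ steps
  ...   | occsᵢ , _ | stepsᵢ , stepₘ =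
    penultimate (last (x List⁺.∷ xs′)) refl (All-last x xs′ occsᵢ)
      (subst (Step S c _) last≡ stepₘ)
    where
    n c : ℕ
    n = length T
    c = length C
    penultimate : ∀ p → last (x List⁺.∷ xs′) ≡ p → Occ S C T p → Step S c p ((n ∸ c) + 1) →
                  Σ ℕ (λ i → (1 ≤ i) × (i ≤ c) × Cov S C (pre T (n ∸ i)))
    penultimate 0       _      (() , _) _
    penultimate (suc q) last≡p _        step with Step⇒+ step
    ... | e , 1≤e , e≤c , L≡ =
      e , 1≤e , e≤c , subst (λ k → Cov S C (take k T)) (sym n∸e≡q+c)
                        (Cov-take q x xs′ q+c≤n occsᵢ x≡1 last≡p stepsᵢ)
      where
      n∸e≡q+c : n ∸ e ≡ q + c
      n∸e≡q+c = n∸c+1≡1+q+e⇒n∸e≡q+c (<⇒≤ c<n) L≡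
      q+c≤n : q + c ≤ n
      q+c≤n = subst (_≤ n) n∸e≡q+c (m∸n≤m n e)

  Cov-pre⇒ProperCov : ∀ {C T i} → Bord S C T → 1 ≤ i → i ≤ length C →
                      Cov S C (pre T (length T ∸ i)) → ProperCov S C T
  Cov-pre⇒ProperCov {C} {T} {i} (C≈pre , pre≈suf) 1≤i i≤c
                    (x List⁺.∷ xs , occs@(occ₁ ∷ _) , x≡1 , last≡ , steps) =
    ( (x List⁺.∷ xs) ⁺∷ʳ L
    , ∷ʳ⁺ (All.map (Occ-take⁻ k) occs) occₘ
    , x≡1
    , last-⁺∷ʳ x xs L
    , Linked-⁺∷ʳ⁺ x xs steps stepₘ )
    , c<n
    where
    n c k L : ℕ
    n = length T
    c = length C
    k = n ∸ i
    L = (n ∸ c) + 1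
    k≤n : k ≤ n
    k≤n = m∸n≤m n i
    c≤k : c ≤ k
    c≤k = subst (c ≤_) (length-take≤ T k≤n) (Occ⇒length≤ occ₁)
    i≤n : i ≤ n
    i≤n = ≤-trans i≤c (≤-trans c≤k k≤n)
    c<n : c < n
    c<n = ≤-<-trans c≤k (∸-monoʳ-< 1≤i i≤n)
    occₘ : Occ S C T L
    occₘ = from (Occ-last⇔ (<⇒≤ c<n)) (≈-trans C≈pre pre≈suf)
    last≡′ : last (x List⁺.∷ xs) ≡ (k ∸ c) + 1
    last≡′ = trans last≡ (cong (λ l → (l ∸ c) + 1) (length-take≤ T k≤n))
    stepₘ : Step S c (last (x List⁺.∷ xs)) L
    stepₘ = subst₂ (Step S c) (sym last≡′) (sym (n∸c+1≡n∸i∸c+1+i i≤n c≤k)) (Step-+ 1≤i i≤c)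

lemma8 : ∀ {a ℓ} {A : Set a} (S : SCER A ℓ) (T C : List A) →
    ProperCov S C T ⇔
      (Bord S C T ×
       Σ ℕ (λ i → (1 ≤ i) × (i ≤ length C) × Cov S C (pre T (length T ∸ i))))
lemma8 S T C = mk⇔
  (λ proper → Cov⇒Bord S (proj₁ proper) , ProperCov⇒Cov-pre S proper)
  (λ (bord , i , 1≤i , i≤c , cov) → Cov-pre⇒ProperCov S bord 1≤i i≤c cov)
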